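{- If $r,s,t\ge 2$ are integers, then $\chi_{\mu_i}(K_r\,\square\, K_s\,\square\, K_t)=\max\{r,s,t\}$.
   Context: All graphs are finite and simple. The Cartesian product $G\,\square\, H$ has vertex set $V(G)\times V(H)$, with $(g,h)$ adjacent to $(g',h')$ iff ($gg'\in E(G)$ and $h=h'$) or ($g=g'$ and $hh'\in E(H)$). A geodesic is a shortest path. For $X\subseteq V(G)$, two vertices $x,y\in X$ are $X$-visible if some $x,y$-geodesic has no internal vertex in $X$; $X$ is an independent mutual-visibility (IMV) set if $X$ is independent and every two of its vertices are $X$-visible. $\chi_{\mu_i}(G)$ is the least $k$ such that $V(G)$ can be partitioned into $k$ IMV sets. -}

module Defs where

open import Data.Nat using (ℕ; zero; suc; _≤_)
open import Data.Fin using (Fin)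
open import Data.Product using (_×_; _,_; Σ; ∃; ∃-syntax)
open import Data.Sum using (_⊎_; inj₁; inj₂)
open import Data.Empty using (⊥)
open import Data.List using (List; []; _∷_)
open import Data.List.Relation.Unary.All using (All)
open import Relation.Nullary using (¬_)
open import Relation.Binary.PropositionalEquality using (_≡_; _≢_; refl; sym)

record Graph : Set₁ where
  field
    V     : Set
    E     : V → V → Set
    E-sym : ∀ {x y} → E x y → E y x
    E-irr : ∀ {x} → ¬ E x x
open Graph public

K : ℕ → Graph
K r = record
  { V = Fin r
  ; E = λ i j → i ≢ j
  ; E-sym = λ p q → p (sym q)
  ; E-irr = λ p → p refl
  }

_□_ : Graph → Graph → Graph
G □ H = record
  { V = V G × V H
  ; E = λ { (g , h) (g' , h') → (E G g g' × h ≡ h') ⊎ (g ≡ g' × E H h h') }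
  ; E-sym = λ { (inj₁ (e , refl)) → inj₁ (E-sym G e , refl)
              ; (inj₂ (refl , e)) → inj₂ (refl , E-sym H e) }
  ; E-irr = λ { (inj₁ (e , _)) → E-irr G e ; (inj₂ (_ , e)) → E-irr H e }
  }
infixl 6 _□_

data Walk (G : Graph) : V G → V G → ℕ → Set where
  here : ∀ x → Walk G x x zero
  step : ∀ {x y z k} → E G x y → Walk G y z k → Walk G x z (suc k)

inner : ∀ {G x y k} → Walk G x y k → List (V G)
inner (here _) = []
inner (step _ (here _)) = []
inner (step {y = y} _ w@(step _ _)) = y ∷ inner w

IsGeodesic : ∀ {G x y k} → Walk G x y k → Set
IsGeodesic {G} {x} {y} {k} _ = ∀ {k'} → Walk G x y k' → k ≤ k'

Subset : Graph → Set₁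
Subset G = V G → Set

Visible : (G : Graph) → Subset G → V G → V G → Set
Visible G X x y =
  ∃[ k ] Σ (Walk G x y k) λ w → IsGeodesic w × All (λ v → ¬ X v) (inner w)

Independent : (G : Graph) → Subset G → Set
Independent G X = ∀ x y → X x → X y → ¬ E G x y

IsIMV : (G : Graph) → Subset G → Set
IsIMV G X = Independent G X × (∀ x y → X x → X y → Visible G X x y)

-- V(G) can be partitioned into k IMV sets (colour classes of c : V → Fin k;
-- empty classes are allowed, which is harmless since ∅ is IMV).
IMVPartition : Graph → ℕ → Set
IMVPartition G k = Σ (V G → Fin k) λ c → ∀ (i : Fin k) → IsIMV G (λ v → c v ≡ i)

χμi≡ : Graph → ℕ → Set
χμi≡ G m = IMVPartition G m × (∀ k → IMVPartition G k → m ≤ k)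

{-# OPTIONS --safe #-}
module Submission where

-- K_r □ K_s □ K_t has diameter at most 3, so a geodesic between two vertices
-- has at most two internal vertices, each adjacent to an end.  Hence every
-- independent set is in mutual visibility, IMV partitions are exactly proper
-- colourings, and χ_μi equals the chromatic number max{r,s,t}: every line is a
-- clique, and (a + b + c) mod max{r,s,t} is a proper colouring.

open import Defs
open import Algebra.Definitions as AlgebraDefs using ()
open import Data.Nat using (ℕ; suc; _≤_; _<_; _≮_; _⊔_; _+_; _*_; _%_; _/_; z≤n; s≤s; z<s; NonZero; >-nonZero)
open import Data.Nat.Properties
open import Data.Nat.DivMod using (m≡m%n+[m/n]*n; m%n<n)
open import Data.Fin using (Fin; toℕ; fromℕ<; inject≤)
open import Data.Fin.Properties using (toℕ<n; toℕ-fromℕ<; toℕ-injective; inject≤-injective; injective⇒≤) renaming (_≟_ to _≟ᶠ_)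
open import Data.Product using (_,_; proj₁; proj₂)
open import Data.Sum using (inj₁; inj₂)
open import Data.List.Relation.Unary.All using (All; []; _∷_)
open import Relation.Nullary using (¬_; yes; no; contradiction)
open import Relation.Nullary.Decidable using (decidable-stable)
open import Relation.Binary.Definitions using (tri<; tri≈; tri>)
open import Relation.Binary.PropositionalEquality using (_≡_; _≢_; refl; sym; trans; cong; cong₂; module ≡-Reasoning)

infixr 5 _++ʷ_

_++ʷ_ : ∀ {G x y z m k} → Walk G x y m → Walk G y z k → Walk G x z (m + k)
here _   ++ʷ w′ = w′
step e w ++ʷ w′ = step e (w ++ʷ w′)

module _ {G H : Graph} where

  Walk-□ˡ : ∀ {g g′ k} h → Walk G g g′ k → Walk (G □ H) (g , h) (g′ , h) k
  Walk-□ˡ h (here g)   = here (g , h)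
  Walk-□ˡ h (step e w) = step (inj₁ (e , refl)) (Walk-□ˡ h w)

  Walk-□ʳ : ∀ {h h′ k} g → Walk H h h′ k → Walk (G □ H) (g , h) (g , h′) k
  Walk-□ʳ g (here h)   = here (g , h)
  Walk-□ʳ g (step e w) = step (inj₂ (refl , e)) (Walk-□ʳ g w)

record Distance (G : Graph) : Set where
  field
    dist     : V G → V G → ℕ
    geodesic : ∀ x y → Walk G x y (dist x y)
    walk-≥   : ∀ {x y k} → Walk G x y k → dist x y ≤ k

  geodesic-isGeodesic : ∀ x y → IsGeodesic (geodesic x y)
  geodesic-isGeodesic x y = walk-≥

  dist-step : ∀ {x y} z → E G x y → dist x z ≤ suc (dist y z)
  dist-step z e = walk-≥ (step e (geodesic _ z))

open Distance

Diameter≤ : ∀ {G} → Distance G → ℕ → Set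
Diameter≤ D d = ∀ x y → dist D x y ≤ d

Distance-K : ∀ n → Distance (K n)
Distance-K n = record { dist = δ ; geodesic = edge ; walk-≥ = δ-≤ }
  where
  δ : Fin n → Fin n → ℕ
  δ i j with i ≟ᶠ j
  ... | yes _ = 0
  ... | no  _ = 1

  edge : ∀ i j → Walk (K n) i j (δ i j)
  edge i j with i ≟ᶠ j
  ... | yes refl = here i
  ... | no  i≢j  = step i≢j (here j)

  δ-≤ : ∀ {i j k} → Walk (K n) i j k → δ i j ≤ k
  δ-≤ {i} {j} w with i ≟ᶠ j | w
  ... | yes _   | _        = z≤n
  ... | no  i≢j | here _   = contradiction refl i≢j
  ... | no  _   | step _ _ = s≤s z≤n

Diameter≤-K : ∀ n → Diameter≤ (Distance-K n) 1
Diameter≤-K n i j with i ≟ᶠ j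
... | yes _ = z≤n
... | no  _ = s≤s z≤n

module _ {G H : Graph} (D : Distance G) (D′ : Distance H) where

  Distance-□ : Distance (G □ H)
  Distance-□ = record { dist = d ; geodesic = γ ; walk-≥ = d-≤ }
    where
    d : V (G □ H) → V (G □ H) → ℕ
    d (g , h) (g′ , h′) = dist D g g′ + dist D′ h h′

    γ : ∀ x y → Walk (G □ H) x y (d x y)
    γ (g , h) (g′ , h′) = Walk-□ˡ h (geodesic D g g′) ++ʷ Walk-□ʳ g′ (geodesic D′ h h′)

    d-≤ : ∀ {x y k} → Walk (G □ H) x y k → d x y ≤ k
    d-≤ (here (g , h)) = +-mono-≤ (walk-≥ D (here g)) (walk-≥ D′ (here h))
    d-≤ {g , h} {y} (step (inj₁ (e , refl)) w) =
      ≤-trans (+-monoˡ-≤ _ (dist-step D (proj₁ y) e)) (s≤s (d-≤ w))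
    d-≤ {g , h} {y} (step (inj₂ (refl , e)) w) =
      ≤-trans (+-monoʳ-≤ (dist D g (proj₁ y)) (dist-step D′ (proj₂ y) e))
        (≤-trans (≤-reflexive (+-suc _ _)) (s≤s (d-≤ w)))

  Diameter≤-□ : ∀ {a b} → Diameter≤ D a → Diameter≤ D′ b → Diameter≤ Distance-□ (a + b)
  Diameter≤-□ diam diam′ (g , h) (g′ , h′) = +-mono-≤ (diam g g′) (diam′ h h′)

module _ {G : Graph} {X : Subset G} (independent : Independent G X) where

  Independent⇒short-walk-avoids : ∀ {x y k} → k ≤ 3 → (w : Walk G x y k) → X x → X y →
                                  All (λ v → ¬ X v) (inner w)
  Independent⇒short-walk-avoids _ (here _)          _  _  = []
  Independent⇒short-walk-avoids _ (step _ (here _)) _  _  = []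
  Independent⇒short-walk-avoids _ (step e (step _ (here _))) Xx _ =
    (λ Xv → independent _ _ Xx Xv e) ∷ []
  Independent⇒short-walk-avoids _ (step e (step _ (step e′ (here _)))) Xx Xy =
    (λ Xv → independent _ _ Xx Xv e) ∷ (λ Xv → independent _ _ Xv Xy e′) ∷ []
  Independent⇒short-walk-avoids (s≤s (s≤s (s≤s ()))) (step _ (step _ (step _ (step _ _)))) _ _

  Independent⇒IMV : (D : Distance G) → Diameter≤ D 3 → IsIMV G X
  Independent⇒IMV D diam = independent , λ x y Xx Xy →
    dist D x y , geodesic D x y , geodesic-isGeodesic D x y ,
    Independent⇒short-walk-avoids (diam x y) (geodesic D x y) Xx Xy

Proper : (G : Graph) {C : Set} → (V G → C) → Set
Proper G f = ∀ {u v} → E G u v → f u ≢ f v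

module _ {G : Graph} {k : ℕ} where

  IMVPartition⇒Proper : ((f , _) : IMVPartition G k) → Proper G f
  IMVPartition⇒Proper (f , imv) {u} {v} e fu≡fv = proj₁ (imv (f v)) u v fu≡fv refl e

  Proper⇒IMVPartition : (D : Distance G) → Diameter≤ D 3 → (f : V G → Fin k) → Proper G f → IMVPartition G k
  Proper⇒IMVPartition D diam f proper = f , λ i →
    Independent⇒IMV (λ u v fu≡i fv≡i e → proper e (trans fu≡i (sym fv≡i))) D diam

χμi≡χ : ∀ {G m} (D : Distance G) → Diameter≤ D 3 →
        (f : V G → Fin m) → Proper G f → (∀ {k} (f′ : V G → Fin k) → Proper G f′ → m ≤ k) →
        χμi≡ G m
χμi≡χ D diam f proper minimal =
  Proper⇒IMVPartition D diam f proper , λ k P → minimal (proj₁ P) (IMVPartition⇒Proper P)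

module _ {G H : Graph} where

  Proper-□ˡ : ∀ {C} {f : V (G □ H) → C} → Proper (G □ H) f → ∀ h → Proper G (λ g → f (g , h))
  Proper-□ˡ proper h e = proper (inj₁ (e , refl))

  Proper-□ʳ : ∀ {C} {f : V (G □ H) → C} → Proper (G □ H) f → ∀ g → Proper H (λ h → f (g , h))
  Proper-□ʳ proper g e = proper (inj₂ (refl , e))

  Proper-□ : ∀ {C} {_∙_ : C → C → C} {f : V G → C} {f′ : V H → C} →
             AlgebraDefs.LeftCancellative _≡_ _∙_ → AlgebraDefs.RightCancellative _≡_ _∙_ →
             Proper G f → Proper H f′ → Proper (G □ H) (λ v → f (proj₁ v) ∙ f′ (proj₂ v))
  Proper-□ {f = f} {f′} cancelˡ cancelʳ proper proper′ {g , h} {g′ , h′} = λ where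
    (inj₁ (e , refl)) eq → proper e (cancelʳ (f′ h) (f g) (f g′) eq)
    (inj₂ (refl , e)) eq → proper′ e (cancelˡ (f g) (f′ h) (f′ h′) eq)

Proper-K⇒≤ : ∀ {m k} {f : Fin m → Fin k} → Proper (K m) f → m ≤ k
Proper-K⇒≤ proper = injective⇒≤ λ {i} {j} eq → decidable-stable (i ≟ᶠ j) λ i≢j → proper i≢j eq

Proper-inject≤ : ∀ {m n} (m≤n : m ≤ n) → Proper (K m) (λ i → inject≤ i m≤n)
Proper-inject≤ m≤n {i} {j} i≢j eq = i≢j (inject≤-injective m≤n m≤n i j eq)

module _ {n : ℕ} .{{_ : NonZero n}} where

  m%n≡o%n∧m/n≡o/n⇒m≡o : ∀ {m o} → m % n ≡ o % n → m / n ≡ o / n → m ≡ o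
  m%n≡o%n∧m/n≡o/n⇒m≡o {m} {o} %≡ /≡ = begin
    m                 ≡⟨ m≡m%n+[m/n]*n m n ⟩
    m % n + m / n * n ≡⟨ cong₂ (λ a b → a + b * n) %≡ /≡ ⟩
    o % n + o / n * n ≡⟨ m≡m%n+[m/n]*n o n ⟨
    o                 ∎
    where open ≡-Reasoning

  m%n≡o%n∧m/n<o/n⇒n+m≤o : ∀ {m o} → m % n ≡ o % n → m / n < o / n → n + m ≤ o
  m%n≡o%n∧m/n<o/n⇒n+m≤o {m} {o} %≡ /< = begin
    n + m                   ≡⟨ cong (n +_) (m≡m%n+[m/n]*n m n) ⟩
    n + (m % n + m / n * n) ≡⟨ +-comm n _ ⟩
    m % n + m / n * n + n   ≡⟨ +-assoc (m % n) _ n ⟩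
    m % n + (m / n * n + n) ≡⟨ cong (m % n +_) (+-comm _ n) ⟩
    m % n + suc (m / n) * n ≤⟨ +-mono-≤ (≤-reflexive %≡) (*-monoˡ-≤ n /<) ⟩
    o % n + o / n * n       ≡⟨ m≡m%n+[m/n]*n o n ⟨
    o                       ∎
    where open ≤-Reasoning

  [x+c]/n≮[y+c]/n : ∀ {x y} c → y < n → (x + c) % n ≡ (y + c) % n → (x + c) / n ≮ (y + c) / n
  [x+c]/n≮[y+c]/n {x} {y} c y<n %≡ /< = <⇒≱ y<n (m+n≤o⇒m≤o n (+-cancelʳ-≤ c (n + x) y n+x+c≤y+c))
    where
    n+x+c≤y+c : n + x + c ≤ y + c
    n+x+c≤y+c = ≤-trans (≤-reflexive (+-assoc n x c)) (m%n≡o%n∧m/n<o/n⇒n+m≤o %≡ /<)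

  +-%-cancelʳ : ∀ {x y} c → x < n → y < n → (x + c) % n ≡ (y + c) % n → x ≡ y
  +-%-cancelʳ {x} {y} c x<n y<n %≡ with <-cmp ((x + c) / n) ((y + c) / n)
  ... | tri< /< _ _ = contradiction /< ([x+c]/n≮[y+c]/n c y<n %≡)
  ... | tri≈ _ /≡ _ = +-cancelʳ-≡ c x y (m%n≡o%n∧m/n≡o/n⇒m≡o %≡ /≡)
  ... | tri> _ _ /> = contradiction /> ([x+c]/n≮[y+c]/n c x<n (sym %≡))

  infixl 6 _⊕_

  _⊕_ : Fin n → Fin n → Fin n
  i ⊕ j = fromℕ< (m%n<n (toℕ i + toℕ j) n)

  ⊕-comm : ∀ i j → i ⊕ j ≡ j ⊕ i
  ⊕-comm i j = cong (λ m → fromℕ< (m%n<n m n)) (+-comm (toℕ i) (toℕ j))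

  ⊕-cancelʳ : AlgebraDefs.RightCancellative _≡_ _⊕_
  ⊕-cancelʳ k i j eq = toℕ-injective (+-%-cancelʳ (toℕ k) (toℕ<n i) (toℕ<n j) (begin
    (toℕ i + toℕ k) % n ≡⟨ toℕ-fromℕ< _ ⟨
    toℕ (i ⊕ k)         ≡⟨ cong toℕ eq ⟩
    toℕ (j ⊕ k)         ≡⟨ toℕ-fromℕ< _ ⟩
    (toℕ j + toℕ k) % n ∎))
    where open ≡-Reasoning

  ⊕-cancelˡ : AlgebraDefs.LeftCancellative _≡_ _⊕_
  ⊕-cancelˡ k i j eq = ⊕-cancelʳ k i j (trans (⊕-comm i k) (trans eq (⊕-comm k j)))

module _ (r s t : ℕ) where

  Distance-K□K□K : Distance (K r □ K s □ K t)
  Distance-K□K□K = Distance-□ (Distance-□ (Distance-K r) (Distance-K s)) (Distance-K t)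

  Diameter≤-K□K□K : Diameter≤ Distance-K□K□K 3
  Diameter≤-K□K□K = Diameter≤-□ (Distance-□ (Distance-K r) (Distance-K s)) (Distance-K t)
    (Diameter≤-□ (Distance-K r) (Distance-K s) (Diameter≤-K r) (Diameter≤-K s)) (Diameter≤-K t)

  module _ {n : ℕ} .{{_ : NonZero n}} (r≤n : r ≤ n) (s≤n : s ≤ n) (t≤n : t ≤ n) where

    sum-colouringʳˢ : V (K r □ K s) → Fin n
    sum-colouringʳˢ (a , b) = inject≤ a r≤n ⊕ inject≤ b s≤n

    sum-colouring : V (K r □ K s □ K t) → Fin n
    sum-colouring (v , c) = sum-colouringʳˢ v ⊕ inject≤ c t≤n

    -- The factor graphs are passed explicitly: adjacency in a product does not determine its factors.
    Proper-sum-colouring : Proper (K r □ K s □ K t) sum-colouring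
    Proper-sum-colouring = Proper-□ {K r □ K s} {K t} ⊕-cancelˡ ⊕-cancelʳ
      (Proper-□ {K r} {K s} ⊕-cancelˡ ⊕-cancelʳ (Proper-inject≤ r≤n) (Proper-inject≤ s≤n))
      (Proper-inject≤ t≤n)

  Proper-K□K□K⇒⊔≤ : Fin r → Fin s → Fin t →
                    ∀ {k} {f : V (K r □ K s □ K t) → Fin k} → Proper (K r □ K s □ K t) f → r ⊔ s ⊔ t ≤ k
  Proper-K□K□K⇒⊔≤ a₀ b₀ c₀ {f = f} proper =
    ⊔-lub (⊔-lub (Proper-K⇒≤ line-r) (Proper-K⇒≤ line-s)) (Proper-K⇒≤ line-t)
    where
    plane : Proper (K r □ K s) (λ v → f (v , c₀))
    plane = Proper-□ˡ {K r □ K s} {K t} proper c₀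

    line-r : Proper (K r) (λ a → f ((a , b₀) , c₀))
    line-r = Proper-□ˡ {K r} {K s} plane b₀

    line-s : Proper (K s) (λ b → f ((a₀ , b) , c₀))
    line-s = Proper-□ʳ {K r} {K s} plane a₀

    line-t : Proper (K t) (λ c → f ((a₀ , b₀) , c))
    line-t = Proper-□ʳ {K r □ K s} {K t} proper (a₀ , b₀)

proposition5p4 : ∀ (r s t : ℕ) → 2 ≤ r → 2 ≤ s → 2 ≤ t →
                   χμi≡ (K r □ K s □ K t) (r ⊔ s ⊔ t)
proposition5p4 r s t 2≤r 2≤s 2≤t =
  χμi≡χ (Distance-K□K□K r s t) (Diameter≤-K□K□K r s t)
    (sum-colouring r s t r≤max s≤max t≤max) (Proper-sum-colouring r s t r≤max s≤max t≤max)
    (λ _ → Proper-K□K□K⇒⊔≤ r s t (fromℕ< 2≤r) (fromℕ< 2≤s) (fromℕ< 2≤t))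
  where
  r≤max : r ≤ r ⊔ s ⊔ t
  r≤max = ≤-trans (m≤m⊔n r s) (m≤m⊔n (r ⊔ s) t)

  s≤max : s ≤ r ⊔ s ⊔ t
  s≤max = ≤-trans (m≤n⊔m r s) (m≤m⊔n (r ⊔ s) t)

  t≤max : t ≤ r ⊔ s ⊔ t
  t≤max = m≤n⊔m (r ⊔ s) t

  instance
    max≢0 : NonZero (r ⊔ s ⊔ t)
    max≢0 = >-nonZero (<-≤-trans z<s (≤-trans 2≤r r≤max))
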